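{- Let $G$ be a finite interval graph and let $I^*$ be a maximum independent set of $G$. Then every independent set $S$ that can be returned by \textsc{Greedy} on $G$ (for any way of breaking ties) satisfies $|S| \geq \frac{2}{3}|I^*|$.
   Context: All graphs are finite, simple and undirected. A graph is an interval graph if its vertices can be represented by closed intervals of the real line so that two vertices are adjacent if and only if their intervals intersect. For a vertex $v$, $N[v]$ is its closed neighbourhood, $d(v)$ its degree, and $\delta(G)$ the minimum degree. The minimum-degree greedy algorithm \textsc{Greedy}: start with $S=\emptyset$; while the current graph $G$ is nonempty, choose any vertex $v$ with $d(v)=\delta(G)$ (ties broken arbitrarily/adversarially), add $v$ to $S$, and replace $G$ by $G\setminus N[v]$. A solution "can be returned by \textsc{Greedy}" if it is the output for some sequence of tie-breaking choices.
   Formalization: The closed intervals representing the vertices of $G$ have rational endpoints rather than real ones. -}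

module Defs where

open import Data.Nat using (ℕ; zero; suc; _+_)
open import Data.Fin using (Fin; zero; suc; _≟_)
open import Data.Bool using (Bool; true; false; _∧_; _∨_; not; if_then_else_)
open import Data.List using (List; []; _∷_)
open import Data.List.Membership.Propositional using (_∈_)
open import Data.List.Relation.Unary.Unique.Propositional using (Unique)
open import Data.Product using (Σ; _×_)
open import Data.Rational using (ℚ) renaming (_≤_ to _≤ℚ_)
open import Relation.Binary.PropositionalEquality using (_≡_; _≢_)
open import Relation.Nullary.Decidable using (⌊_⌋)
open import Function.Bundles using (_⇔_)

record Graph (n : ℕ) : Set where
  field
    adj    : Fin n → Fin n → Bool
    sym    : ∀ u v → adj u v ≡ adj v u
    irrefl : ∀ v → adj v v ≡ false
open Graph public

IsIntervalGraph : ∀ {n} → Graph n → Set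
IsIntervalGraph {n} G =
  Σ (Fin n → ℚ) λ l → Σ (Fin n → ℚ) λ r →
    (∀ v → l v ≤ℚ r v) ×
    (∀ u v → u ≢ v → ((adj G u v ≡ true) ⇔ ((l u ≤ℚ r v) × (l v ≤ℚ r u))))

VSet : ℕ → Set
VSet n = Fin n → Bool

count : ∀ {n} → VSet n → ℕ
count {zero}  U = 0
count {suc n} U = (if U zero then 1 else 0) + count {n} (λ i → U (suc i))

deg : ∀ {n} → Graph n → VSet n → Fin n → ℕ
deg G U v = count (λ w → U w ∧ adj G v w)

removeClosedNbhd : ∀ {n} → Graph n → VSet n → Fin n → VSet n
removeClosedNbhd G U v w = U w ∧ not (⌊ w ≟ v ⌋ ∨ adj G v w)

-- GreedyRun G U S : the list S (in order of choice) is a possible output of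
-- the minimum-degree greedy algorithm started on the induced subgraph G[U].
data GreedyRun {n} (G : Graph n) : VSet n → List (Fin n) → Set where
  done : ∀ {U} → (∀ v → U v ≡ false) → GreedyRun G U []
  step : ∀ {U S} (v : Fin n) →
         U v ≡ true →
         (∀ w → U w ≡ true → deg G U v Data.Nat.≤ deg G U w) →
         GreedyRun G (removeClosedNbhd G U v) S →
         GreedyRun G U (v ∷ S)

GreedyOutput : ∀ {n} → Graph n → List (Fin n) → Set
GreedyOutput G S = GreedyRun G (λ _ → true) S

Independent : ∀ {n} → Graph n → List (Fin n) → Set
Independent G I = Unique I × (∀ u v → u ∈ I → v ∈ I → adj G u v ≡ false)

MaximumIndependent : ∀ {n} → Graph n → List (Fin n) → Set
MaximumIndependent {n} G I =
  Independent G I × (∀ (J : List (Fin n)) → Independent G J → Data.List.length J Data.Nat.≤ Data.List.length I)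

{-# OPTIONS --safe #-}
module Submission where

-- Invariant: along every run of Greedy on an induced subgraph G[U] with output S, every
-- independent set I ⊆ U satisfies 2|I| + c(U) ≤ 3|S|, where c(U) is the number of connected
-- components of G[U].  Let Greedy pick v of minimum degree.
-- I meets N[v] in at most two vertices: of three pairwise non-adjacent neighbours of v, the
-- middle interval has all its neighbours in N[v] and misses the outer two, so it would have
-- smaller degree than v.  If I meets N[v] in two vertices a, b (a to the left of b),
-- minimality of v again gives each of them a neighbour outside N[v], one on each side of v,
-- so deleting N[v] creates a new component; in any case it destroys at most one.  Hence
-- 2|I ∩ N[v]| + c(U) ≤ 3 + c(U ∖ N[v]), and induction along the run gives the invariant.

open import Defs hiding (sym)
open import Data.Nat using (ℕ; zero; suc; _+_; _*_; _≤_; z≤n; s≤s)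
open import Data.Nat.Properties
  using ( ≤-trans; ≤-reflexive; n≤1+n; +-suc; +-monoˡ-≤; +-monoʳ-≤; m≤m+n; m≤n+m; *-suc; 1+n≰n
        ; module ≤-Reasoning)
import Data.Nat.Properties as ℕ
open import Data.Nat.Tactic.RingSolver using (solve-∀)
open import Data.Fin using (Fin; zero; suc; toℕ; _≟_)
open import Data.Fin.Properties using (suc-injective; 0≢1+n; toℕ-injective; any?; all?)
open import Data.Bool using (Bool; true; false; _∧_; _∨_; not)
open import Data.Bool.Properties using (∧-conicalˡ; ∧-conicalʳ; ∧-zeroʳ; not-injective; ¬-not)
import Data.Bool as Bool
open import Data.Rational using (ℚ; _<_) renaming (_≤_ to _≤ℚ_)
import Data.Rational.Properties as ℚ
open import Data.List using (List; []; _∷_; length; filter; partition; allFin; _++_)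
open import Data.List.Properties using (length-++; partition-defn)
open import Data.List.Membership.Propositional using (_∈_)
open import Data.List.Membership.Propositional.Properties using (∈-filter⁺; ∈-filter⁻; ∈-allFin)
open import Data.List.Relation.Unary.Any using (here; there)
open import Data.List.Relation.Unary.All using ([]; _∷_)
import Data.List.Relation.Unary.All as All
open import Data.List.Relation.Unary.All.Properties using (all-filter)
open import Data.List.Relation.Unary.AllPairs using (_∷_)
open import Data.List.Relation.Unary.Unique.Propositional.Properties using (filter⁺)
open import Data.List.Relation.Binary.Permutation.Setoid.Properties
  using (partition-↭; xs↭ys⇒|xs|≡|ys|)
open import Data.Empty using (⊥; ⊥-elim)
open import Data.Sum using (_⊎_; inj₁; inj₂)
open import Data.Product using (∃-syntax; _×_; _,_; proj₁; proj₂)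
open import Data.Product.Relation.Binary.Lex.NonStrict using (×-decTotalOrder)
open import Function using (_∘_)
open import Function.Bundles using (_⇔_; Equivalence)
open import Level using (Level)
open import Relation.Binary.Bundles using (DecTotalOrder)
open import Relation.Binary.PropositionalEquality
  using (_≡_; _≢_; refl; sym; trans; cong; subst; setoid; module ≡-Reasoning)
open import Relation.Nullary using (¬_; Dec; yes; no)
open import Relation.Nullary.Decidable using (⌊_⌋; _→-dec_; _×-dec_)
open import Relation.Unary using (Pred; Decidable)
open import Relation.Unary.Properties using (∁?)

private
  variable
    ℓ : Level
    n : ℕ

⌊⌋-intro : ∀ {A : Set ℓ} (a? : Dec A) → A → ⌊ a? ⌋ ≡ true
⌊⌋-intro (yes _) _ = refl
⌊⌋-intro (no ¬a) a = ⊥-elim (¬a a)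

⌊⌋-elim : ∀ {A : Set ℓ} (a? : Dec A) → ⌊ a? ⌋ ≡ true → A
⌊⌋-elim (yes a) _ = a

true≢false : ∀ {b} → b ≡ true → b ≢ false
true≢false refl ()

module _ {a b : Bool} where

  ∧-intro : a ≡ true → b ≡ true → a ∧ b ≡ true
  ∧-intro refl refl = refl

  ∧-elim : a ∧ b ≡ true → a ≡ true × b ≡ true
  ∧-elim p = ∧-conicalˡ a b p , ∧-conicalʳ a b p

  ∧-not-intro : a ≡ true → b ≡ false → a ∧ not b ≡ true
  ∧-not-intro refl refl = refl

  ∧-not-elim : a ∧ not b ≡ true → a ≡ true × b ≡ false
  ∧-not-elim p = ∧-conicalˡ a (not b) p , not-injective (∧-conicalʳ a (not b) p)

  ∧-falseˡ : a ≡ false → a ∧ b ≡ false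
  ∧-falseˡ refl = refl

  ∧-falseʳ : b ≡ false → a ∧ b ≡ false
  ∧-falseʳ refl = ∧-zeroʳ a

length-filter-∁ : ∀ {A : Set} {P : Pred A ℓ} (P? : Decidable P) (xs : List A) →
                  length xs ≡ length (filter P? xs) + length (filter (∁? P?) xs)
length-filter-∁ P? xs = begin
  length xs              ≡⟨ xs↭ys⇒|xs|≡|ys| (setoid _) (partition-↭ (setoid _) P? xs) ⟩
  length (ys ++ zs)      ≡⟨ length-++ ys ⟩
  length ys + length zs  ≡⟨ cong (λ (ys , zs) → length ys + length zs) (partition-defn P? xs) ⟩
  length (filter P? xs) + length (filter (∁? P?) xs) ∎
  where
  open ≡-Reasoning
  ys zs : List _
  ys = proj₁ (partition P? xs)
  zs = proj₂ (partition P? xs)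

module _ {c ℓ₁ ℓ₂} (O : DecTotalOrder c ℓ₁ ℓ₂) where
  open DecTotalOrder O using (Carrier; totalOrder) renaming (_≤_ to _≤ₒ_)
  open import Data.List.Extrema totalOrder using (argmax; argmax-all; f[xs]≤f[argmax])

  argmax-exists : (f : Fin n → Carrier) {P : Pred (Fin n) ℓ} → Decidable P → ∀ {y} → P y →
                  ∃[ w ] P w × (∀ x → P x → f x ≤ₒ f w)
  argmax-exists f P? {y} Py =
    w , argmax-all f Py (all-filter P? (allFin _)) ,
    λ x Px → All.lookup (f[xs]≤f[argmax] y xs) (∈-filter⁺ P? (∈-allFin x) Px)
    where
    xs = filter P? (allFin _)
    w  = argmax f y xs

infix  4 _⊆_
infixl 7 _∩_
infixl 6 _∪_ _∖_

_⊆_ : VSet n → VSet n → Set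
f ⊆ g = ∀ x → f x ≡ true → g x ≡ true

_∩_ _∪_ _∖_ : VSet n → VSet n → VSet n
(f ∩ g) x = f x ∧ g x
(f ∪ g) x = f x ∨ g x
(f ∖ g) x = f x ∧ not (g x)

｛_｝ : Fin n → VSet n
｛ a ｝ x = ⌊ x ≟ a ⌋

Subsingleton : VSet n → Set
Subsingleton f = ∀ x y → f x ≡ true → f y ≡ true → x ≡ y

∈｛｝ : (a : Fin n) → ｛ a ｝ a ≡ true
∈｛｝ a = ⌊⌋-intro (a ≟ a) refl

∉｛｝ : {a x : Fin n} → x ≢ a → ｛ a ｝ x ≡ false
∉｛｝ x≢a = ¬-not (x≢a ∘ ⌊⌋-elim (_ ≟ _))

count-≡0 : (f : VSet n) → (∀ x → f x ≡ false) → count f ≡ 0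
count-≡0 {zero}  f empty = refl
count-≡0 {suc n} f empty with f zero | empty zero
... | false | _ = count-≡0 (f ∘ suc) (empty ∘ suc)

count-mono : {f g : VSet n} → f ⊆ g → count f ≤ count g
count-mono {zero}              f⊆g = z≤n
count-mono {suc n} {f} {g} f⊆g with f zero in f₀ | g zero in g₀
... | true  | true  = s≤s (count-mono (f⊆g ∘ suc))
... | true  | false = ⊥-elim (true≢false (f⊆g zero f₀) g₀)
... | false | true  = ≤-trans (count-mono (f⊆g ∘ suc)) (n≤1+n _)
... | false | false = count-mono (f⊆g ∘ suc)

count-⊂ : {f g : VSet n} {a : Fin n} → f ⊆ g → g a ≡ true → f a ≡ false →
          suc (count f) ≤ count g
count-⊂ {suc n} {f} {g} {zero} f⊆g ga fa with f zero | g zero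
count-⊂ {suc n} {f} {g} {zero} f⊆g refl refl | false | true = s≤s (count-mono (f⊆g ∘ suc))
count-⊂ {suc n} {f} {g} {suc a} f⊆g ga fa with f zero in f₀ | g zero in g₀
... | true  | true  = s≤s (count-⊂ (f⊆g ∘ suc) ga fa)
... | true  | false = ⊥-elim (true≢false (f⊆g zero f₀) g₀)
... | false | true  = ≤-trans (count-⊂ (f⊆g ∘ suc) ga fa) (n≤1+n _)
... | false | false = count-⊂ (f⊆g ∘ suc) ga fa

count-⊂₂ : {f g : VSet n} {a b : Fin n} → f ⊆ g → a ≢ b →
           g a ≡ true → g b ≡ true → f a ≡ false → f b ≡ false →
           2 + count f ≤ count g
count-⊂₂ {f = f} {g} {a} {b} f⊆g a≢b ga gb fa fb = begin
  2 + count f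
    ≤⟨ s≤s (count-⊂ f⊆g∖a (∧-not-intro gb (∉｛｝ (a≢b ∘ sym))) fb) ⟩
  suc (count (g ∖ ｛ a ｝))
    ≤⟨ count-⊂ {f = g ∖ ｛ a ｝} (λ _ → proj₁ ∘ ∧-not-elim) ga (∧-falseʳ (cong not (∈｛｝ a))) ⟩
  count g ∎
  where
  open ≤-Reasoning
  f⊆g∖a : f ⊆ g ∖ ｛ a ｝
  f⊆g∖a x fx = ∧-not-intro (f⊆g x fx) (∉｛｝ λ { refl → true≢false fx fa })

count-∩-∖ : (f g : VSet n) → count f ≡ count (f ∩ g) + count (f ∖ g)
count-∩-∖ {zero}  f g = refl
count-∩-∖ {suc n} f g with f zero | g zero
... | true  | true  = cong suc (count-∩-∖ (f ∘ suc) (g ∘ suc))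
... | true  | false = trans (cong suc (count-∩-∖ (f ∘ suc) (g ∘ suc))) (sym (+-suc _ _))
... | false | _     = count-∩-∖ (f ∘ suc) (g ∘ suc)

count-subsingleton : {f : VSet n} → Subsingleton f → count f ≤ 1
count-subsingleton {zero}          _   = z≤n
count-subsingleton {suc n} {f} sub with f zero in f₀
... | true  = ≤-reflexive (cong suc (count-≡0 (f ∘ suc) rest-empty))
  where
  rest-empty : ∀ x → f (suc x) ≡ false
  rest-empty x = ¬-not (0≢1+n ∘ sub zero (suc x) f₀)
... | false = count-subsingleton (λ x y fx fy → suc-injective (sub (suc x) (suc y) fx fy))

count-≤-suc-∖ : {f g : VSet n} → Subsingleton (f ∩ g) → count f ≤ suc (count (f ∖ g))
count-≤-suc-∖ {f = f} {g} sub =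
  ≤-trans (≤-reflexive (count-∩-∖ f g)) (+-monoˡ-≤ _ (count-subsingleton sub))

count-<-except : {f g : VSet n} {v a b : Fin n} → f ∖ ｛ v ｝ ⊆ g → a ≢ b →
                 g a ≡ true → g b ≡ true → f a ≡ false → f b ≡ false →
                 suc (count f) ≤ count g
count-<-except {f = f} {g} {v} f∖v⊆g a≢b ga gb fa fb =
  ≤-trans (s≤s (count-≤-suc-∖ {g = ｛ v ｝} at-most-v))
          (count-⊂₂ f∖v⊆g a≢b ga gb (∧-falseˡ fa) (∧-falseˡ fb))
  where
  at-most-v : Subsingleton (f ∩ ｛ v ｝)
  at-most-v x y p q =
    trans (⌊⌋-elim (x ≟ v) (proj₂ (∧-elim p))) (sym (⌊⌋-elim (y ≟ v) (proj₂ (∧-elim q))))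

module Neighbourhoods (G : Graph n) where

  N[_] : Fin n → VSet n
  N[ v ] = ｛ v ｝ ∪ adj G v

  N[]-elim : ∀ {v x} → N[ v ] x ≡ true → x ≢ v → adj G v x ≡ true
  N[]-elim {v} {x} p x≢v with x ≟ v
  ... | yes x≡v = ⊥-elim (x≢v x≡v)
  ... | no _    = p

  N[]-independent : ∀ {v x y} → N[ v ] x ≡ true → N[ v ] y ≡ true → x ≢ y →
                    adj G x y ≡ false → adj G v x ≡ true
  N[]-independent {v} {x} x∈ y∈ x≢y xy with x ≟ v
  ... | no _     = x∈
  ... | yes refl = ⊥-elim (true≢false (N[]-elim y∈ (x≢y ∘ sym)) xy)

  independent-filter : ∀ {P : Pred (Fin n) ℓ} (P? : Decidable P) {I} →
                       Independent G I → Independent G (filter P? I)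
  independent-filter P? (unique , independent) =
    filter⁺ P? unique ,
    λ u w u∈ w∈ → independent u w (proj₁ (∈-filter⁻ P? u∈)) (proj₁ (∈-filter⁻ P? w∈))

  deg-< : ∀ {U m v a b} →
          (∀ x → U x ≡ true → adj G m x ≡ true → x ≢ v → adj G v x ≡ true) →
          a ≢ b → (U ∩ adj G v) a ≡ true → (U ∩ adj G v) b ≡ true →
          adj G m a ≡ false → adj G m b ≡ false → suc (deg G U m) ≤ deg G U v
  deg-< {U} {m} {v} N⊆N a≢b a∈ b∈ ma mb =
    count-<-except {f = U ∩ adj G m} {v = v} N∖v⊆N a≢b a∈ b∈ (∧-falseʳ ma) (∧-falseʳ mb)
    where
    N∖v⊆N : (U ∩ adj G m) ∖ ｛ v ｝ ⊆ U ∩ adj G v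
    N∖v⊆N x p with ∧-not-elim p
    ... | x∈ , x∉｛v｝ with ∧-elim x∈
    ...   | Ux , mx = ∧-intro Ux (N⊆N x Ux mx λ { refl → true≢false (∈｛｝ x) x∉｛v｝ })

  module MinimumDegree (U : VSet n) (v : Fin n)
                       (minimal : ∀ w → U w ≡ true → deg G U v ≤ deg G U w) where

    U' Nᵥ : VSet n
    U' = U ∖ N[ v ]
    Nᵥ = U ∩ adj G v

    escape : ∀ {a b} → a ≢ b → Nᵥ a ≡ true → Nᵥ b ≡ true → adj G a b ≡ false →
             ∃[ a' ] U' a' ≡ true × adj G a a' ≡ true
    escape {a} a≢b a∈ b∈ ab with any? (λ x → (U' ∩ adj G a) x Bool.≟ true)
    ... | yes (a' , p) = a' , ∧-elim p
    ... | no none      = ⊥-elim (1+n≰n (≤-trans (deg-< trapped a≢b a∈ b∈ (irrefl G a) ab)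
                                                 (minimal a (proj₁ (∧-elim a∈)))))
      where
      trapped : ∀ x → U x ≡ true → adj G a x ≡ true → x ≢ v → adj G v x ≡ true
      trapped x Ux ax x≢v with N[ v ] x in x∈N
      ... | true  = N[]-elim x∈N x≢v
      ... | false = ⊥-elim (none (x , ∧-intro (∧-not-intro Ux x∈N) ax))

module IntervalGreedy (G : Graph n) (l r : Fin n → ℚ) (l≤r : ∀ v → l v ≤ℚ r v)
  (adj⇔meet : ∀ u v → u ≢ v → ((adj G u v ≡ true) ⇔ ((l u ≤ℚ r v) × (l v ≤ℚ r u)))) where

  open Neighbourhoods G

  infix 4 _◁_ _◁?_ _≼_

  _◁_ : Fin n → Fin n → Set
  x ◁ y = r x < l y

  _◁?_ : ∀ x y → Dec (x ◁ y)
  x ◁? y = r x ℚ.<? l y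

  ◁-trans : ∀ {x y z} → x ◁ y → y ◁ z → x ◁ z
  ◁-trans {y = y} x◁y y◁z = ℚ.<-trans x◁y (ℚ.≤-<-trans (l≤r y) y◁z)

  ◁-irrefl : ∀ {x} → ¬ x ◁ x
  ◁-irrefl {x} x◁x = ℚ.<-irrefl refl (ℚ.<-≤-trans x◁x (l≤r x))

  adj⇒meet : ∀ {x y} → adj G x y ≡ true → l x ≤ℚ r y × l y ≤ℚ r x
  adj⇒meet {x} {y} xy with x ≟ y
  ... | yes refl = ⊥-elim (true≢false xy (irrefl G x))
  ... | no x≢y   = Equivalence.to (adj⇔meet x y x≢y) xy

  ◁⇒¬adj : ∀ {x y} → x ◁ y → adj G x y ≡ false
  ◁⇒¬adj x◁y = ¬-not λ xy → ℚ.<-irrefl refl (ℚ.<-≤-trans x◁y (proj₂ (adj⇒meet xy)))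

  ▷⇒¬adj : ∀ {x y} → y ◁ x → adj G x y ≡ false
  ▷⇒¬adj y◁x = ¬-not λ xy → ℚ.<-irrefl refl (ℚ.<-≤-trans y◁x (proj₁ (adj⇒meet xy)))

  ¬meet⇒◁⊎▷ : ∀ {x y} → ¬ (l x ≤ℚ r y × l y ≤ℚ r x) → x ◁ y ⊎ y ◁ x
  ¬meet⇒◁⊎▷ {x} {y} ¬meet with l x ℚ.≤? r y | l y ℚ.≤? r x
  ... | no  ¬p | _      = inj₂ (ℚ.≰⇒> ¬p)
  ... | yes _  | no  ¬q = inj₁ (ℚ.≰⇒> ¬q)
  ... | yes p  | yes q  = ⊥-elim (¬meet (p , q))

  ¬adj⇒◁⊎▷ : ∀ {x y} → x ≢ y → adj G x y ≡ false → x ◁ y ⊎ y ◁ x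
  ¬adj⇒◁⊎▷ {x} {y} x≢y xy =
    ¬meet⇒◁⊎▷ λ meet → true≢false (Equivalence.from (adj⇔meet x y x≢y) meet) xy

  meet⇒N[] : ∀ {v x} → l v ≤ℚ r x → l x ≤ℚ r v → N[ v ] x ≡ true
  meet⇒N[] {v} {x} p q with x ≟ v
  ... | yes _   = refl
  ... | no x≢v  = Equivalence.from (adj⇔meet v x (x≢v ∘ sym)) (p , q)

  N[]⇒meet : ∀ {v x} → N[ v ] x ≡ true → l v ≤ℚ r x × l x ≤ℚ r v
  N[]⇒meet {v} {x} p with x ≟ v
  ... | yes refl = l≤r v , l≤r v
  ... | no _     = adj⇒meet p

  ∉N[]⇒◁⊎▷ : ∀ {v x} → N[ v ] x ≡ false → x ◁ v ⊎ v ◁ x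
  ∉N[]⇒◁⊎▷ x∉N = ¬meet⇒◁⊎▷ λ (p , q) → true≢false (meet⇒N[] q p) x∉N

  -- Right endpoints, ties broken by vertex index: every component of G[U] then has exactly
  -- one ≼-last interval.
  keyOrder : DecTotalOrder _ _ _
  keyOrder = ×-decTotalOrder ℚ.≤-decTotalOrder ℕ.≤-decTotalOrder

  open DecTotalOrder keyOrder using ()
    renaming (_≤_ to _≤ₖ_; _≤?_ to _≤ₖ?_; antisym to ≤ₖ-antisym)

  key : Fin n → ℚ × ℕ
  key x = r x , toℕ x

  _≼_ : Fin n → Fin n → Set
  x ≼ y = key x ≤ₖ key y

  ≼⇒≤ : ∀ {x y} → x ≼ y → r x ≤ℚ r y
  ≼⇒≤ (inj₁ (r≤r , _)) = r≤r
  ≼⇒≤ (inj₂ (r≡r , _)) = ℚ.≤-reflexive r≡r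

  <⇒≼ : ∀ {x y} → r x < r y → x ≼ y
  <⇒≼ r<r = inj₁ (ℚ.<⇒≤ r<r , ℚ.<⇒≢ r<r)

  ≼-antisym : ∀ {x y} → x ≼ y → y ≼ x → x ≡ y
  ≼-antisym x≼y y≼x = toℕ-injective (proj₂ (≤ₖ-antisym x≼y y≼x))

  -- w is the ≼-last interval of its connected component of G[U], so #components U counts
  -- those components.
  EndsComponent : VSet n → Fin n → Set
  EndsComponent U w = ∀ x → U x ≡ true → l x ≤ℚ r w → x ≼ w

  endsComponent? : ∀ U w → Dec (EndsComponent U w)
  endsComponent? U w =
    all? λ x → (U x Bool.≟ true) →-dec (l x ℚ.≤? r w) →-dec (key x ≤ₖ? key w)

  ends : VSet n → VSet n
  ends U w = U w ∧ ⌊ endsComponent? U w ⌋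

  #components : VSet n → ℕ
  #components U = count (ends U)

  module _ (U : VSet n) {w : Fin n} where

    ends-intro : U w ≡ true → EndsComponent U w → ends U w ≡ true
    ends-intro Uw end = ∧-intro Uw (⌊⌋-intro (endsComponent? U w) end)

    ends-elim : ends U w ≡ true → U w ≡ true × EndsComponent U w
    ends-elim p = proj₁ (∧-elim p) , ⌊⌋-elim (endsComponent? U w) (proj₂ (∧-elim p))

    ends-false : ¬ EndsComponent U w → ends U w ≡ false
    ends-false ¬end = ¬-not (¬end ∘ proj₂ ∘ ends-elim)

  module Step (U : VSet n) (v : Fin n) (v∈U : U v ≡ true)
              (minimal : ∀ w → U w ≡ true → deg G U v ≤ deg G U w) where

    open MinimumDegree U v minimal public
    open ℚ.≤-Reasoning

    no-middle : ∀ {a m b} → Nᵥ a ≡ true → Nᵥ m ≡ true → Nᵥ b ≡ true → a ◁ m → m ◁ b → ⊥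
    no-middle {a} {m} {b} a∈ m∈ b∈ a◁m m◁b =
      1+n≰n (≤-trans (deg-< between a≢b a∈ b∈ (▷⇒¬adj a◁m) (◁⇒¬adj m◁b))
                     (minimal m (proj₁ (∧-elim m∈))))
      where
      a≢b : a ≢ b
      a≢b refl = ◁-irrefl (◁-trans a◁m m◁b)
      between : ∀ x → U x ≡ true → adj G m x ≡ true → x ≢ v → adj G v x ≡ true
      between x _ mx = N[]-elim (meet⇒N[] (ℚ.<⇒≤ v<x) (ℚ.<⇒≤ x<v))
        where
        v<x : l v < r x
        v<x = begin-strict
          l v ≤⟨ proj₁ (adj⇒meet (proj₂ (∧-elim a∈))) ⟩ r a <⟨ a◁m ⟩
          l m ≤⟨ proj₁ (adj⇒meet mx) ⟩ r x ∎
        x<v : l x < r v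
        x<v = begin-strict
          l x ≤⟨ proj₂ (adj⇒meet mx) ⟩ r m <⟨ m◁b ⟩
          l b ≤⟨ proj₂ (adj⇒meet (proj₂ (∧-elim b∈))) ⟩ r v ∎

    escape-left : ∀ {a b} → a ◁ b → Nᵥ a ≡ true → Nᵥ b ≡ true →
                  ∃[ a' ] U' a' ≡ true × adj G a a' ≡ true × a' ◁ v
    escape-left {a} {b} a◁b a∈ b∈ with escape (λ { refl → ◁-irrefl a◁b }) a∈ b∈ (◁⇒¬adj a◁b)
    ... | a' , a'∈ , aa' with ∉N[]⇒◁⊎▷ (proj₂ (∧-not-elim a'∈))
    ...   | inj₁ a'◁v = a' , a'∈ , aa' , a'◁v
    ...   | inj₂ v◁a' = ⊥-elim (ℚ.<-irrefl refl (begin-strict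
      r v  <⟨ v◁a' ⟩ l a' ≤⟨ proj₂ (adj⇒meet aa') ⟩ r a <⟨ a◁b ⟩
      l b  ≤⟨ proj₂ (adj⇒meet (proj₂ (∧-elim b∈))) ⟩ r v ∎))

    escape-right : ∀ {a b} → a ◁ b → Nᵥ a ≡ true → Nᵥ b ≡ true →
                   ∃[ b' ] U' b' ≡ true × adj G b b' ≡ true × v ◁ b'
    escape-right {a} {b} a◁b a∈ b∈ with escape (λ { refl → ◁-irrefl a◁b }) b∈ a∈ (▷⇒¬adj a◁b)
    ... | b' , b'∈ , bb' with ∉N[]⇒◁⊎▷ (proj₂ (∧-not-elim b'∈))
    ...   | inj₂ v◁b' = b' , b'∈ , bb' , v◁b'
    ...   | inj₁ b'◁v = ⊥-elim (ℚ.<-irrefl refl (begin-strict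
      r b' <⟨ b'◁v ⟩ l v ≤⟨ proj₁ (adj⇒meet (proj₂ (∧-elim a∈))) ⟩ r a <⟨ a◁b ⟩
      l b  ≤⟨ proj₁ (adj⇒meet bb') ⟩ r b' ∎))

    -- The ≼-last interval of U' left of v ends a component of U', but not of U: a crosses it.
    fresh-end-left : ∀ {a a'} → Nᵥ a ≡ true → U' a' ≡ true → adj G a a' ≡ true → a' ◁ v →
                     ∃[ w ] ends U' w ≡ true × ends U w ≡ false × w ◁ v
    fresh-end-left {a} {a'} a∈ a'∈ aa' a'◁v
      with argmax-exists keyOrder key (λ x → (U' x Bool.≟ true) ×-dec (x ◁? v)) (a'∈ , a'◁v)
    ... | w , (w∈ , w◁v) , max = w , ends-intro U' w∈ end′ , ends-false U ¬end , w◁v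
      where
      end′ : EndsComponent U' w
      end′ x x∈ lx≤rw with ∉N[]⇒◁⊎▷ (proj₂ (∧-not-elim x∈))
      ... | inj₁ x◁v = max x (x∈ , x◁v)
      ... | inj₂ v◁x = ⊥-elim (ℚ.<-irrefl refl (begin-strict
        r v <⟨ v◁x ⟩ l x ≤⟨ lx≤rw ⟩ r w <⟨ w◁v ⟩ l v ≤⟨ l≤r v ⟩ r v ∎))
      ¬end : ¬ EndsComponent U w
      ¬end end = ℚ.<-irrefl refl (begin-strict
        r a ≤⟨ ≼⇒≤ (end a (proj₁ (∧-elim a∈)) la≤rw) ⟩ r w <⟨ w◁v ⟩
        l v ≤⟨ proj₁ (adj⇒meet (proj₂ (∧-elim a∈))) ⟩ r a ∎)
        where
        la≤rw : l a ≤ℚ r w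
        la≤rw = ℚ.≤-trans (proj₁ (adj⇒meet aa')) (≼⇒≤ (max a' (a'∈ , a'◁v)))

    module _ {t : Fin n} (t∈ : (ends U ∩ N[ v ]) t ≡ true) where

      t∈U : U t ≡ true
      t∈U = proj₁ (ends-elim U (proj₁ (∧-elim t∈)))

      t-ends : EndsComponent U t
      t-ends = proj₂ (ends-elim U (proj₁ (∧-elim t∈)))

      ≤t : ∀ {x} → U x ≡ true → l x ≤ℚ r t → r x ≤ℚ r t
      ≤t {x} Ux lx≤rt = ≼⇒≤ (t-ends x Ux lx≤rt)

      v≤t : r v ≤ℚ r t
      v≤t = ≤t v∈U (proj₁ (N[]⇒meet (proj₂ (∧-elim t∈))))

      -- The component of U ending at t loses t, but the ≼-last interval of U' right of v
      -- ending by r t is a new end, distinct from t as it lies outside N[v].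
      fresh-end-right : ∀ {b b'} → Nᵥ b ≡ true → U' b' ≡ true → adj G b b' ≡ true → v ◁ b' →
                        ∃[ w ] ends U' w ≡ true × ends U w ≡ false × v ◁ w
      fresh-end-right {b} {b'} b∈ b'∈ bb' v◁b'
        with argmax-exists keyOrder key
               (λ x → (U' x Bool.≟ true) ×-dec (v ◁? x) ×-dec (r x ℚ.≤? r t)) (b'∈ , v◁b' , b'≤t)
        where
        b≤t : r b ≤ℚ r t
        b≤t = ≤t (proj₁ (∧-elim b∈)) (ℚ.≤-trans (proj₂ (adj⇒meet (proj₂ (∧-elim b∈)))) v≤t)
        b'≤t : r b' ≤ℚ r t
        b'≤t = ≤t (proj₁ (∧-not-elim b'∈)) (ℚ.≤-trans (proj₂ (adj⇒meet bb')) b≤t)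
      ... | w , (w∈ , v◁w , w≤t) , max = w , ends-intro U' w∈ end′ , ends-false U ¬end , v◁w
        where
        end′ : EndsComponent U' w
        end′ x x∈ lx≤rw with ∉N[]⇒◁⊎▷ (proj₂ (∧-not-elim x∈))
        ... | inj₂ v◁x = max x (x∈ , v◁x , ≤t (proj₁ (∧-not-elim x∈)) (ℚ.≤-trans lx≤rw w≤t))
        ... | inj₁ x◁v = <⇒≼ (begin-strict
          r x <⟨ x◁v ⟩ l v ≤⟨ l≤r v ⟩ r v <⟨ v◁w ⟩ l w ≤⟨ l≤r w ⟩ r w ∎)
        lt≤rw : l t ≤ℚ r w
        lt≤rw = ℚ.<⇒≤ (begin-strict
          l t ≤⟨ proj₂ (N[]⇒meet (proj₂ (∧-elim t∈))) ⟩ r v <⟨ v◁w ⟩ l w ≤⟨ l≤r w ⟩ r w ∎)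
        ¬end : ¬ EndsComponent U w
        ¬end end = true≢false (proj₂ (∧-elim t∈))
                              (subst (λ x → N[ v ] x ≡ false) w≡t (proj₂ (∧-not-elim w∈)))
          where
          w≡t : w ≡ t
          w≡t = ≼-antisym (t-ends w (proj₁ (∧-not-elim w∈)) (ℚ.≤-trans (l≤r w) w≤t))
                          (end t t∈U lt≤rw)

    one-end-in-N[] : Subsingleton (ends U ∩ N[ v ])
    one-end-in-N[] t₁ t₂ t₁∈ t₂∈ = ≼-antisym (below t₁∈ t₂∈) (below t₂∈ t₁∈)
      where
      below : ∀ {x y} (x∈ : (ends U ∩ N[ v ]) x ≡ true) (y∈ : (ends U ∩ N[ v ]) y ≡ true) → x ≼ y
      below {x} x∈ y∈ =
        t-ends y∈ x (t∈U x∈) (ℚ.≤-trans (proj₂ (N[]⇒meet (proj₂ (∧-elim x∈)))) (v≤t y∈))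

    ends-survive : ends U ∖ N[ v ] ⊆ ends U'
    ends-survive x p with ∧-not-elim p
    ... | x-ends , x∉N with ends-elim U x-ends
    ...   | Ux , end = ends-intro U' (∧-not-intro Ux x∉N) (λ y y∈ → end y (proj₁ (∧-not-elim y∈)))

    #components-drop : #components U ≤ suc (#components U')
    #components-drop = ≤-trans (count-≤-suc-∖ one-end-in-N[]) (s≤s (count-mono ends-survive))

    #components-split : ∀ {a b} → a ◁ b → Nᵥ a ≡ true → Nᵥ b ≡ true →
                        suc (#components U) ≤ #components U'
    #components-split a◁b a∈ b∈ with escape-left a◁b a∈ b∈ | escape-right a◁b a∈ b∈
    ... | a' , a'∈ , aa' , a'◁v | b' , b'∈ , bb' , v◁b' with fresh-end-left a∈ a'∈ aa' a'◁v
    ... | w , w-ends′ , w-¬ends , w◁v with any? (λ t → (ends U ∩ N[ v ]) t Bool.≟ true)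
    ... | no none = count-⊂ all-survive w-ends′ w-¬ends
      where
      all-survive : ends U ⊆ ends U'
      all-survive x x-ends =
        ends-survive x (∧-not-intro x-ends (¬-not λ x∈N → none (x , ∧-intro x-ends x∈N)))
    ... | yes (t , t∈) with fresh-end-right t∈ b∈ b'∈ bb' v◁b'
    ...   | w₂ , w₂-ends′ , w₂-¬ends , v◁w₂ =
      ≤-trans (s≤s (count-≤-suc-∖ one-end-in-N[]))
              (count-⊂₂ ends-survive (λ { refl → ◁-irrefl (◁-trans w◁v v◁w₂) })
                        w-ends′ w₂-ends′ (∧-falseˡ w-¬ends) (∧-falseˡ w₂-¬ends))

    #components-split-¬adj : ∀ {a b} → a ≢ b → adj G a b ≡ false → Nᵥ a ≡ true → Nᵥ b ≡ true →
                             suc (#components U) ≤ #components U'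
    #components-split-¬adj a≢b ab a∈ b∈ with ¬adj⇒◁⊎▷ a≢b ab
    ... | inj₁ a◁b = #components-split a◁b a∈ b∈
    ... | inj₂ b◁a = #components-split b◁a b∈ a∈

    no-three : ∀ {x y z} → Nᵥ x ≡ true → Nᵥ y ≡ true → Nᵥ z ≡ true →
               x ◁ y ⊎ y ◁ x → y ◁ z ⊎ z ◁ y → x ◁ z ⊎ z ◁ x → ⊥
    no-three x∈ y∈ z∈ (inj₁ x◁y) (inj₁ y◁z) _          = no-middle x∈ y∈ z∈ x◁y y◁z
    no-three x∈ y∈ z∈ (inj₁ x◁y) (inj₂ z◁y) (inj₁ x◁z) = no-middle x∈ z∈ y∈ x◁z z◁y
    no-three x∈ y∈ z∈ (inj₁ x◁y) (inj₂ z◁y) (inj₂ z◁x) = no-middle z∈ x∈ y∈ z◁x x◁y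
    no-three x∈ y∈ z∈ (inj₂ y◁x) (inj₁ y◁z) (inj₁ x◁z) = no-middle y∈ x∈ z∈ y◁x x◁z
    no-three x∈ y∈ z∈ (inj₂ y◁x) (inj₁ y◁z) (inj₂ z◁x) = no-middle y∈ z∈ x∈ y◁z z◁x
    no-three x∈ y∈ z∈ (inj₂ y◁x) (inj₂ z◁y) _          = no-middle z∈ y∈ x∈ z◁y y◁x

    neighbour : ∀ {J x y} → Independent G J → (∀ z → z ∈ J → (U ∩ N[ v ]) z ≡ true) →
                x ∈ J → y ∈ J → x ≢ y → Nᵥ x ≡ true
    neighbour (_ , independent) J⊆ x∈ y∈ x≢y =
      ∧-intro (proj₁ (∧-elim (J⊆ _ x∈)))
              (N[]-independent (proj₂ (∧-elim (J⊆ _ x∈))) (proj₂ (∧-elim (J⊆ _ y∈))) x≢y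
                               (independent _ _ x∈ y∈))

    gain : (J : List (Fin n)) → Independent G J → (∀ x → x ∈ J → (U ∩ N[ v ]) x ≡ true) →
           2 * length J + #components U ≤ 3 + #components U'
    gain []           _ _ = ≤-trans #components-drop (m≤n+m _ 2)
    gain (_ ∷ [])     _ _ = s≤s (s≤s #components-drop)
    gain (x ∷ y ∷ []) J-ind@(((x≢y ∷ []) ∷ _) , independent) J⊆ =
      s≤s (s≤s (s≤s (#components-split-¬adj x≢y (independent x y x∈ y∈)
                       (neighbour J-ind J⊆ x∈ y∈ x≢y) (neighbour J-ind J⊆ y∈ x∈ (x≢y ∘ sym)))))
      where
      x∈ : x ∈ x ∷ y ∷ []
      x∈ = here refl
      y∈ : y ∈ x ∷ y ∷ []
      y∈ = there (here refl)
    gain (x ∷ y ∷ z ∷ J) J-ind@(((x≢y ∷ x≢z ∷ _) ∷ (y≢z ∷ _) ∷ _) , independent) J⊆ =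
      ⊥-elim (no-three (neighbour J-ind J⊆ x∈ y∈ x≢y) (neighbour J-ind J⊆ y∈ x∈ (x≢y ∘ sym))
                       (neighbour J-ind J⊆ z∈ x∈ (x≢z ∘ sym))
                       (order x∈ y∈ x≢y) (order y∈ z∈ y≢z) (order x∈ z∈ x≢z))
      where
      x∈ : x ∈ x ∷ y ∷ z ∷ J
      x∈ = here refl
      y∈ : y ∈ x ∷ y ∷ z ∷ J
      y∈ = there (here refl)
      z∈ : z ∈ x ∷ y ∷ z ∷ J
      z∈ = there (there (here refl))
      order : ∀ {p q} → p ∈ x ∷ y ∷ z ∷ J → q ∈ x ∷ y ∷ z ∷ J → p ≢ q → p ◁ q ⊎ q ◁ p
      order p∈ q∈ p≢q = ¬adj⇒◁⊎▷ p≢q (independent _ _ p∈ q∈)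

  greedy-invariant : ∀ {U S} → GreedyRun G U S → (I : List (Fin n)) → Independent G I →
                     (∀ x → x ∈ I → U x ≡ true) → 2 * length I + #components U ≤ 3 * length S
  greedy-invariant {U} (done empty) [] _ _ =
    ≤-reflexive (count-≡0 (ends U) (λ x → ∧-falseˡ (empty x)))
  greedy-invariant (done empty) (x ∷ _) _ I⊆U = ⊥-elim (true≢false (I⊆U x (here refl)) (empty x))
  greedy-invariant {U} (step {S = S} v v∈U minimal run) I I-ind I⊆U = begin
    2 * length I + #components U
      ≡⟨ cong (λ k → 2 * k + #components U) (length-filter-∁ P? I) ⟩
    2 * (length J + length K) + #components U
      ≡⟨ regroup (length J) (length K) (#components U) ⟩
    2 * length K + (2 * length J + #components U)
      ≤⟨ +-monoʳ-≤ (2 * length K) (gain J (independent-filter P? I-ind) J⊆) ⟩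
    2 * length K + (3 + #components U')
      ≡⟨ regroup′ (2 * length K) (#components U') ⟩
    3 + (2 * length K + #components U')
      ≤⟨ +-monoʳ-≤ 3 (greedy-invariant run K (independent-filter (∁? P?) I-ind) K⊆) ⟩
    3 + 3 * length S
      ≡⟨ *-suc 3 (length S) ⟨
    3 * suc (length S) ∎
    where
    open Step U v v∈U minimal
    open ≤-Reasoning
    P? : Decidable (λ x → N[ v ] x ≡ true)
    P? x = N[ v ] x Bool.≟ true
    J K : List (Fin n)
    J = filter P? I
    K = filter (∁? P?) I
    J⊆ : ∀ x → x ∈ J → (U ∩ N[ v ]) x ≡ true
    J⊆ x x∈ with ∈-filter⁻ P? {xs = I} x∈
    ... | x∈I , x∈N = ∧-intro (I⊆U x x∈I) x∈N
    K⊆ : ∀ x → x ∈ K → U' x ≡ true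
    K⊆ x x∈ with ∈-filter⁻ (∁? P?) {xs = I} x∈
    ... | x∈I , x∉N = ∧-not-intro (I⊆U x x∈I) (¬-not x∉N)
    regroup : ∀ j k c → 2 * (j + k) + c ≡ 2 * k + (2 * j + c)
    regroup = solve-∀
    regroup′ : ∀ k c → k + (3 + c) ≡ 3 + (k + c)
    regroup′ = solve-∀

theorem2 : ∀ {n} (G : Graph n) → IsIntervalGraph G →
    (Istar : List (Fin n)) → MaximumIndependent G Istar →
    (S : List (Fin n)) → GreedyOutput G S →
    2 * length Istar ≤ 3 * length S
theorem2 G (l , r , l≤r , adj⇔meet) Istar (Istar-independent , _) S run =
  ≤-trans (m≤m+n _ _) (greedy-invariant run Istar Istar-independent (λ _ _ → refl))
  where open IntervalGreedy G l r l≤r adj⇔meet
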